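{- Let $e\geq 3$ be an integer and let $n$ be a positive integer with $n\equiv 2e+1 \pmod{4e}$. If $n>2e+1$, there exists an $e$-star system of order $n$ which is $(n-1)$-block-colourable. If $n=2e+1$, every $e$-star system of order $2e+1$ is $n$-block-chromatic.
   Context: For an integer $e\ge 1$, an $e$-star is a copy of the complete bipartite graph $K_{1,e}$. An $e$-star system of order $n$ is a pair $(V,\mathcal{B})$ where $|V|=n$ and $\mathcal{B}$ is a set of $e$-stars (subgraphs of the complete graph $K_n$ on $V$) whose edge sets partition the edge set of $K_n$; the elements of $\mathcal B$ are called blocks. A block-colouring of such a system is a partition of $\mathcal{B}$ into colour classes such that the blocks in each colour class are pairwise vertex-disjoint. The system is $k$-block-colourable if it admits a block-colouring with $k$ colour classes, and $k$-block-chromatic if it is $k$-block-colourable but not $(k-1)$-block-colourable. -}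

module Defs where

open import Data.Nat using (ℕ; pred)
open import Data.Fin using (Fin)
open import Data.Fin.Subset using (Subset; _∈_; _∉_; ∣_∣)
open import Data.Product using (Σ; _×_; _,_)
open import Data.Sum using (_⊎_)
open import Relation.Binary.PropositionalEquality using (_≡_; _≢_)
open import Relation.Nullary using (¬_)

record Star (n e : ℕ) : Set where
  field
    centre    : Fin n
    leaves    : Subset n
    centre∉   : centre ∉ leaves
    leavesCard : ∣ leaves ∣ ≡ e
open Star public

HasEdge : ∀ {n e} → Star n e → Fin n → Fin n → Set
HasEdge s u v = (centre s ≡ u × v ∈ leaves s) ⊎ (centre s ≡ v × u ∈ leaves s)

HasVertex : ∀ {n e} → Star n e → Fin n → Set
HasVertex s v = (centre s ≡ v) ⊎ (v ∈ leaves s)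

record StarSystem (n e : ℕ) : Set where
  field
    numBlocks : ℕ
    block     : Fin numBlocks → Star n e
    partition : ∀ (u v : Fin n) → u ≢ v →
                Σ (Fin numBlocks) λ i →
                  HasEdge (block i) u v ×
                  (∀ j → HasEdge (block j) u v → j ≡ i)
open StarSystem public

IsBlockColouring : ∀ {n e} (S : StarSystem n e) (k : ℕ) →
                   (Fin (numBlocks S) → Fin k) → Set
IsBlockColouring S k c =
  ∀ i j → i ≢ j → c i ≡ c j →
    ∀ v → ¬ (HasVertex (block S i) v × HasVertex (block S j) v)

BlockColourable : ∀ {n e} → StarSystem n e → ℕ → Set
BlockColourable S k = Σ (Fin (numBlocks S) → Fin k) λ c → IsBlockColouring S k c

BlockChromatic : ∀ {n e} → StarSystem n e → ℕ → Set
BlockChromatic S k = BlockColourable S k × ¬ BlockColourable S (pred k)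

module Submission where

-- For n = 2e + 1, counting edges shows that an e-star system has exactly n blocks, and two
-- e-stars on 2e + 1 vertices always meet (each spans e + 1 of them), so distinct blocks need
-- distinct colours.
--
-- For n = 1 + 2e(2k + 1) with k ≥ 1, put m = 2k + 1 and take the vertices ∞ and (s, q) with
-- s ∈ ℤₘ, q ∈ ℤ₂ₑ. Every vertex is the centre of m stars: ∞ of one star onto {(r, q) ∣ q < e}
-- for each r; a point (s, q) of one internal star onto the e successors of q in its own group
-- (∞ replacing the antipode when q ≥ e), and of a cross star onto each half of the group s + d,
-- for every distance 1 ≤ d ≤ k. Colour with ℤₘ × ℤ₂ₑ, i.e. n − 1 colours: (2r, 1) at ∞,
-- (2s, q) for internal stars except (2s + 1, 0) when q = 1, and (2s + d, q + [upper half]) for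
-- cross stars. As 2 is invertible modulo the odd m, the first coordinate tells apart stars of
-- different groups that share a vertex, and the second does the rest.

open import Data.Nat using (ℕ; _≤_)

module Counting where

  open import Data.Nat using (ℕ; zero; suc; _+_; _*_; _∸_; _≤_; _<_; z≤n; s≤s; _≤?_; _<?_)
  open import Data.Nat.Properties
  open import Data.Bool using (true; false; if_then_else_)
  open import Data.Fin using (Fin; zero; suc; toℕ; _↑ˡ_; _↑ʳ_; combine)
  open import Data.Fin.Properties as Finₚ using () renaming (_≟_ to _≟ᶠ_)
  open import Data.Fin.Subset using (Subset; ∣_∣)
  open import Data.Fin.Subset.Properties using (_∈?_)
  open import Data.Vec using ([]; _∷_; tabulate)
  open import Data.Product using (_×_; _,_)
  open import Data.Empty using (⊥-elim)
  open import Function using (_∘_)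
  open import Relation.Nullary using (¬_; Dec; yes; no; does; _because_; ¬?)
  open import Relation.Nullary.Decidable using (_×-dec_; _⊎-dec_)
  open import Relation.Binary.PropositionalEquality
  open import Algebra.Properties.Semiring.Sum +-*-semiring public
    using (sum; sum-syntax; sum-cong-≗; ∑-distrib-+; ∑-comm; *-distribˡ-sum; *-distribʳ-sum)

  -- Defined through does, not by matching on the decision, so that it computes on decisions
  -- built with Dec.map′ such as _∈?_.
  ⟦_⟧ : ∀ {p} {P : Set p} → Dec P → ℕ
  ⟦ P? ⟧ = if does P? then 1 else 0

  module _ {p q} {P : Set p} {Q : Set q} where

    ⟦⟧-cong : (P → Q) → (Q → P) → (P? : Dec P) (Q? : Dec Q) → ⟦ P? ⟧ ≡ ⟦ Q? ⟧
    ⟦⟧-cong _ _ (true  because _) (true  because _) = refl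
    ⟦⟧-cong _ _ (false because _) (false because _) = refl
    ⟦⟧-cong f _ (yes p) (no ¬q) = ⊥-elim (¬q (f p))
    ⟦⟧-cong _ g (no ¬p) (yes q) = ⊥-elim (¬p (g q))

    ⟦⟧-× : (P? : Dec P) (Q? : Dec Q) → ⟦ P? ×-dec Q? ⟧ ≡ ⟦ P? ⟧ * ⟦ Q? ⟧
    ⟦⟧-× (true  because _) (true  because _) = refl
    ⟦⟧-× (true  because _) (false because _) = refl
    ⟦⟧-× (false because _) _                 = refl

    ⟦⟧-⊎ : (P? : Dec P) (Q? : Dec Q) → ¬ (P × Q) → ⟦ P? ⊎-dec Q? ⟧ ≡ ⟦ P? ⟧ + ⟦ Q? ⟧
    ⟦⟧-⊎ (yes p)           (yes q)           disj = ⊥-elim (disj (p , q))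
    ⟦⟧-⊎ (true  because _) (false because _) _    = refl
    ⟦⟧-⊎ (false because _) (true  because _) _    = refl
    ⟦⟧-⊎ (false because _) (false because _) _    = refl

    ⟦⟧+⟦⟧≤1 : (P? : Dec P) (Q? : Dec Q) → ¬ (P × Q) → ⟦ P? ⟧ + ⟦ Q? ⟧ ≤ 1
    ⟦⟧+⟦⟧≤1 (yes p)           (yes q)           disj = ⊥-elim (disj (p , q))
    ⟦⟧+⟦⟧≤1 (true  because _) (false because _) _    = ≤-refl
    ⟦⟧+⟦⟧≤1 (false because _) (true  because _) _    = ≤-refl
    ⟦⟧+⟦⟧≤1 (false because _) (false because _) _    = z≤n

  module _ {p} {P : Set p} where

    ⟦⟧-yes : P → (P? : Dec P) → ⟦ P? ⟧ ≡ 1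
    ⟦⟧-yes _ (yes _) = refl
    ⟦⟧-yes p (no ¬p) = ⊥-elim (¬p p)

    ⟦⟧-no : ¬ P → (P? : Dec P) → ⟦ P? ⟧ ≡ 0
    ⟦⟧-no ¬p (yes p) = ⊥-elim (¬p p)
    ⟦⟧-no _  (no _)  = refl

    ⟦¬⟧+⟦⟧≡1 : (P? : Dec P) → ⟦ ¬? P? ⟧ + ⟦ P? ⟧ ≡ 1
    ⟦¬⟧+⟦⟧≡1 (true  because _) = refl
    ⟦¬⟧+⟦⟧≡1 (false because _) = refl

  sum-const : ∀ n c → ∑[ i < n ] c ≡ n * c
  sum-const zero    c = refl
  sum-const (suc n) c = cong (c +_) (sum-const n c)

  sum-zero : ∀ n {f : Fin n → ℕ} → (∀ i → f i ≡ 0) → sum f ≡ 0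
  sum-zero n f≡0 = trans (sum-cong-≗ f≡0) (trans (sum-const n 0) (*-zeroʳ n))

  sum-mono-≤ : ∀ n {f g : Fin n → ℕ} → (∀ i → f i ≤ g i) → sum f ≤ sum g
  sum-mono-≤ zero    f≤g = z≤n
  sum-mono-≤ (suc n) f≤g = +-mono-≤ (f≤g zero) (sum-mono-≤ n (f≤g ∘ suc))

  sum-single : ∀ n (f : Fin n → ℕ) (c : Fin n) → (∀ i → i ≢ c → f i ≡ 0) → sum f ≡ f c
  sum-single (suc n) f zero f≡0 =
    trans (cong (f zero +_) (sum-zero n (λ i → f≡0 (suc i) λ ()))) (+-identityʳ _)
  sum-single (suc n) f (suc c) f≡0 =
    trans (cong (_+ sum (f ∘ suc)) (f≡0 zero λ ()))
          (sum-single n (f ∘ suc) c λ i i≢c → f≡0 (suc i) (i≢c ∘ Finₚ.suc-injective))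

  sum-↑ : ∀ a b (f : Fin (a + b) → ℕ) →
          sum f ≡ ∑[ i < a ] f (i ↑ˡ b) + ∑[ j < b ] f (a ↑ʳ j)
  sum-↑ zero    b f = refl
  sum-↑ (suc a) b f = trans (cong (f zero +_) (sum-↑ a b (f ∘ suc))) (sym (+-assoc (f zero) _ _))

  sum-combine : ∀ a b (f : Fin (a * b) → ℕ) → sum f ≡ ∑[ i < a ] ∑[ j < b ] f (combine i j)
  sum-combine zero    b f = refl
  sum-combine (suc a) b f =
    trans (sum-↑ b (a * b) f) (cong (∑[ j < b ] f (j ↑ˡ (a * b)) +_) (sum-combine a b (f ∘ (b ↑ʳ_))))

  sum-select : ∀ n (c : Fin n) (f : Fin n → ℕ) → ∑[ u < n ] (⟦ c ≟ᶠ u ⟧ * f u) ≡ f c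
  sum-select n c f =
    trans (sum-single n _ c (λ u u≢c → cong (_* f u) (⟦⟧-no (u≢c ∘ sym) (c ≟ᶠ u))))
          (trans (cong (_* f c) (⟦⟧-yes refl (c ≟ᶠ c))) (+-identityʳ (f c)))

  count-× : ∀ a b {p q} {P : Fin a → Set p} {Q : Fin b → Set q} (P? : ∀ i → Dec (P i)) (Q? : ∀ j → Dec (Q j)) →
            ∑[ i < a ] ∑[ j < b ] ⟦ P? i ×-dec Q? j ⟧ ≡ ∑[ i < a ] ⟦ P? i ⟧ * ∑[ j < b ] ⟦ Q? j ⟧
  count-× a b P? Q? = begin
    ∑[ i < a ] ∑[ j < b ] ⟦ P? i ×-dec Q? j ⟧     ≡⟨ sum-cong-≗ {a} (λ i → sum-cong-≗ {b} λ j → ⟦⟧-× (P? i) (Q? j)) ⟩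
    ∑[ i < a ] ∑[ j < b ] (⟦ P? i ⟧ * ⟦ Q? j ⟧)   ≡⟨ sum-cong-≗ {a} (λ i → *-distribˡ-sum ⟦ P? i ⟧ (⟦_⟧ ∘ Q?)) ⟨
    ∑[ i < a ] (⟦ P? i ⟧ * ∑[ j < b ] ⟦ Q? j ⟧)   ≡⟨ *-distribʳ-sum (∑[ j < b ] ⟦ Q? j ⟧) (⟦_⟧ ∘ P?) ⟨
    ∑[ i < a ] ⟦ P? i ⟧ * ∑[ j < b ] ⟦ Q? j ⟧     ∎
    where open ≡-Reasoning

  module _ (n : ℕ) {p} {P : Fin n → Set p} (P? : ∀ i → Dec (P i)) where

    count-none : (∀ i → ¬ P i) → ∑[ i < n ] ⟦ P? i ⟧ ≡ 0
    count-none ¬P = sum-zero n (λ i → ⟦⟧-no (¬P i) (P? i))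

    count-unique : ∀ c → P c → (∀ i → P i → i ≡ c) → ∑[ i < n ] ⟦ P? i ⟧ ≡ 1
    count-unique c Pc unique =
      trans (sum-single n _ c (λ i i≢c → ⟦⟧-no (i≢c ∘ unique i) (P? i))) (⟦⟧-yes Pc (P? c))

    count-cong : ∀ {q} {Q : Fin n → Set q} (Q? : ∀ i → Dec (Q i)) →
                 (∀ i → P i → Q i) → (∀ i → Q i → P i) → ∑[ i < n ] ⟦ P? i ⟧ ≡ ∑[ i < n ] ⟦ Q? i ⟧
    count-cong Q? P⇒Q Q⇒P = sum-cong-≗ (λ i → ⟦⟧-cong (P⇒Q i) (Q⇒P i) (P? i) (Q? i))

    ∣tabulate∣≡count : ∣ tabulate (does ∘ P?) ∣ ≡ ∑[ i < n ] ⟦ P? i ⟧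
    ∣tabulate∣≡count = go n P?
      where
      go : ∀ n {P : Fin n → Set p} (P? : ∀ i → Dec (P i)) → ∣ tabulate (does ∘ P?) ∣ ≡ ∑[ i < n ] ⟦ P? i ⟧
      go zero    P? = refl
      go (suc n) P? with P? zero
      ... | true  because _ = cong suc (go n (P? ∘ suc))
      ... | false because _ = go n (P? ∘ suc)

  count-≟ : ∀ n (c : Fin n) → ∑[ i < n ] ⟦ c ≟ᶠ i ⟧ ≡ 1
  count-≟ n c = count-unique n (c ≟ᶠ_) c refl (λ _ c≡i → sym c≡i)

  count-∈ : ∀ {n} (L : Subset n) → ∑[ v < n ] ⟦ v ∈? L ⟧ ≡ ∣ L ∣
  count-∈ {zero}  []          = refl
  count-∈ {suc n} (true  ∷ L) = cong suc (count-∈ L)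
  count-∈ {suc n} (false ∷ L) = count-∈ L

  InRange : ℕ → ℕ → ℕ → Set
  InRange lo hi x = lo ≤ x × x < hi

  inRange? : ∀ lo hi x → Dec (InRange lo hi x)
  inRange? lo hi x = (lo ≤? x) ×-dec (x <? hi)

  count-range : ∀ N lo hi → hi ≤ N → ∑[ q < N ] ⟦ inRange? lo hi (toℕ q) ⟧ ≡ hi ∸ lo
  count-range zero    lo       zero     _          = sym (0∸n≡0 lo)
  count-range (suc N) zero     zero     _          = count-none (suc N) (λ q → inRange? 0 0 (toℕ q)) (λ _ ())
  count-range (suc N) (suc lo) zero     _          = count-none (suc N) (λ q → inRange? (suc lo) 0 (toℕ q)) (λ _ ())
  count-range (suc N) zero     (suc hi) (s≤s hi≤N) =
    cong suc (trans (count-cong N (λ q → inRange? 0 (suc hi) (toℕ (suc q))) (λ q → inRange? 0 hi (toℕ q))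
                      (λ _ (_ , x<hi) → z≤n , ≤-pred x<hi) (λ _ (_ , x<hi) → z≤n , s≤s x<hi))
                    (count-range N 0 hi hi≤N))
  count-range (suc N) (suc lo) (suc hi) (s≤s hi≤N) =
    trans (count-cong N (λ q → inRange? (suc lo) (suc hi) (toℕ (suc q))) (λ q → inRange? lo hi (toℕ q))
            (λ _ (lo<x , x<hi) → ≤-pred lo<x , ≤-pred x<hi) (λ _ (lo≤x , x<hi) → s≤s lo≤x , s≤s x<hi))
          (count-range N lo hi hi≤N)

module StarSystems where

  open import Defs
  open Counting
  open import Data.Nat using (ℕ; suc; _+_; _*_; _≤_; _<_; NonZero; >-nonZero)
  open import Data.Nat.Properties
  open import Data.Fin using (Fin; combine; remQuot)
  open import Data.Fin.Properties using (remQuot-combine; combine-remQuot; pigeonhole)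
    renaming (_≟_ to _≟ᶠ_; <⇒≢ to <⇒≢ᶠ)
  open import Data.Fin.Subset using (Subset; _∈_)
  open import Data.Fin.Subset.Properties using (_∈?_)
  open import Data.Vec using (tabulate)
  open import Data.Vec.Properties using (lookup∘tabulate; []=⇒lookup; lookup⇒[]=)
  open import Data.Product using (Σ; ∃; _×_; _,_; proj₁; proj₂; uncurry)
  open import Data.Sum using (_⊎_; inj₁; inj₂)
  open import Data.Empty using (⊥-elim)
  open import Function using (_∘_)
  open import Relation.Nullary using (¬_; Dec; yes; no; does; proof; ¬?)
  open import Relation.Nullary.Reflects using (Reflects; invert)
  open import Relation.Nullary.Decidable using (_×-dec_; _⊎-dec_; dec-true)
  open import Relation.Binary.PropositionalEquality

  Disjoint : ∀ {n e} → Star n e → Star n e → Set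
  Disjoint s₁ s₂ = ∀ v → ¬ (HasVertex s₁ v × HasVertex s₂ v)

  module _ {n e : ℕ} where

    hasEdge? : (s : Star n e) (u v : Fin n) → Dec (HasEdge s u v)
    hasEdge? s u v = ((centre s ≟ᶠ u) ×-dec (v ∈? leaves s)) ⊎-dec ((centre s ≟ᶠ v) ×-dec (u ∈? leaves s))

    hasVertex? : (s : Star n e) (v : Fin n) → Dec (HasVertex s v)
    hasVertex? s v = (centre s ≟ᶠ v) ⊎-dec (v ∈? leaves s)

    module _ (s : Star n e) where

      private
        c = centre s
        L = leaves s

      count-leaves : ∑[ v < n ] ⟦ v ∈? L ⟧ ≡ e
      count-leaves = trans (count-∈ L) (leavesCard s)

      ⟦hasEdge⟧ : ∀ u v → ⟦ hasEdge? s u v ⟧ ≡ ⟦ c ≟ᶠ u ⟧ * ⟦ v ∈? L ⟧ + ⟦ c ≟ᶠ v ⟧ * ⟦ u ∈? L ⟧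
      ⟦hasEdge⟧ u v = begin
        ⟦ hasEdge? s u v ⟧
          ≡⟨ ⟦⟧-⊎ ((c ≟ᶠ u) ×-dec (v ∈? L)) ((c ≟ᶠ v) ×-dec (u ∈? L)) centre-not-both ⟩
        ⟦ (c ≟ᶠ u) ×-dec (v ∈? L) ⟧ + ⟦ (c ≟ᶠ v) ×-dec (u ∈? L) ⟧
          ≡⟨ cong₂ _+_ (⟦⟧-× (c ≟ᶠ u) (v ∈? L)) (⟦⟧-× (c ≟ᶠ v) (u ∈? L)) ⟩
        ⟦ c ≟ᶠ u ⟧ * ⟦ v ∈? L ⟧ + ⟦ c ≟ᶠ v ⟧ * ⟦ u ∈? L ⟧ ∎
        where
        open ≡-Reasoning
        centre-not-both : ¬ ((c ≡ u × v ∈ L) × (c ≡ v × u ∈ L))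
        centre-not-both ((refl , v∈L) , (refl , _)) = centre∉ s v∈L

      count-edges : ∑[ u < n ] ∑[ v < n ] ⟦ hasEdge? s u v ⟧ ≡ e + e
      count-edges = begin
        ∑[ u < n ] ∑[ v < n ] ⟦ hasEdge? s u v ⟧
          ≡⟨ sum-cong-≗ (λ u → trans (sum-cong-≗ (⟦hasEdge⟧ u)) (∑-distrib-+ (outgoing u) (incoming u))) ⟩
        ∑[ u < n ] (sum (outgoing u) + sum (incoming u))
          ≡⟨ ∑-distrib-+ (sum ∘ outgoing) (sum ∘ incoming) ⟩
        ∑[ u < n ] sum (outgoing u) + ∑[ u < n ] sum (incoming u)
          ≡⟨ cong₂ _+_ (trans (sum-cong-≗ λ u → sym (*-distribˡ-sum ⟦ c ≟ᶠ u ⟧ (λ v → ⟦ v ∈? L ⟧)))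
                              (sum-select n c (λ _ → ∑[ v < n ] ⟦ v ∈? L ⟧)))
                       (sum-cong-≗ λ u → sum-select n c (λ _ → ⟦ u ∈? L ⟧)) ⟩
        ∑[ v < n ] ⟦ v ∈? L ⟧ + ∑[ u < n ] ⟦ u ∈? L ⟧
          ≡⟨ cong₂ _+_ count-leaves count-leaves ⟩
        e + e ∎
        where
        open ≡-Reasoning
        outgoing incoming : Fin n → Fin n → ℕ
        outgoing u v = ⟦ c ≟ᶠ u ⟧ * ⟦ v ∈? L ⟧
        incoming u v = ⟦ c ≟ᶠ v ⟧ * ⟦ u ∈? L ⟧

      count-vertices : ∑[ v < n ] ⟦ hasVertex? s v ⟧ ≡ suc e
      count-vertices = begin
        ∑[ v < n ] ⟦ hasVertex? s v ⟧
          ≡⟨ sum-cong-≗ (λ v → ⟦⟧-⊎ (c ≟ᶠ v) (v ∈? L) λ { (refl , v∈L) → centre∉ s v∈L }) ⟩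
        ∑[ v < n ] (⟦ c ≟ᶠ v ⟧ + ⟦ v ∈? L ⟧)
          ≡⟨ ∑-distrib-+ (λ v → ⟦ c ≟ᶠ v ⟧) (λ v → ⟦ v ∈? L ⟧) ⟩
        ∑[ v < n ] ⟦ c ≟ᶠ v ⟧ + ∑[ v < n ] ⟦ v ∈? L ⟧
          ≡⟨ cong₂ _+_ (trans (sum-cong-≗ λ v → sym (*-identityʳ ⟦ c ≟ᶠ v ⟧)) (sum-select n c (λ _ → 1)))
                       count-leaves ⟩
        suc e ∎
        where open ≡-Reasoning

    ¬disjoint : n < suc e + suc e → (s₁ s₂ : Star n e) → ¬ Disjoint s₁ s₂
    ¬disjoint n<2e+2 s₁ s₂ disjoint = <⇒≱ n<2e+2 (begin
      suc e + suc e
        ≡⟨ sym (cong₂ _+_ (count-vertices s₁) (count-vertices s₂)) ⟩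
      ∑[ v < n ] ⟦ hasVertex? s₁ v ⟧ + ∑[ v < n ] ⟦ hasVertex? s₂ v ⟧
        ≡⟨ sym (∑-distrib-+ (⟦_⟧ ∘ hasVertex? s₁) (⟦_⟧ ∘ hasVertex? s₂)) ⟩
      ∑[ v < n ] (⟦ hasVertex? s₁ v ⟧ + ⟦ hasVertex? s₂ v ⟧)
        ≤⟨ sum-mono-≤ n (λ v → ⟦⟧+⟦⟧≤1 (hasVertex? s₁ v) (hasVertex? s₂ v) (disjoint v)) ⟩
      ∑[ v < n ] 1
        ≡⟨ trans (sum-const n 1) (*-identityʳ n) ⟩
      n ∎)
      where open ≤-Reasoning

  module _ {n e : ℕ} (S : StarSystem n e) where

    private
      N = numBlocks S

    count-blocks-through : ∀ u v → ∑[ b < N ] ⟦ hasEdge? (block S b) u v ⟧ ≡ ⟦ ¬? (u ≟ᶠ v) ⟧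
    count-blocks-through u v with u ≟ᶠ v
    ... | yes refl = count-none N (λ b → hasEdge? (block S b) u u) λ where
            b (inj₁ (refl , u∈L)) → centre∉ (block S b) u∈L
            b (inj₂ (refl , u∈L)) → centre∉ (block S b) u∈L
    ... | no u≢v with partition S u v u≢v
    ...   | b , uv∈b , unique = count-unique N (λ b → hasEdge? (block S b) u v) b uv∈b unique

    count-distinct : ∀ u → ∑[ v < n ] ⟦ ¬? (u ≟ᶠ v) ⟧ + 1 ≡ n
    count-distinct u = begin
      ∑[ v < n ] ⟦ ¬? (u ≟ᶠ v) ⟧ + 1
        ≡⟨ cong (∑[ v < n ] ⟦ ¬? (u ≟ᶠ v) ⟧ +_)
                (sym (trans (sum-cong-≗ λ v → sym (*-identityʳ ⟦ u ≟ᶠ v ⟧)) (sum-select n u (λ _ → 1)))) ⟩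
      ∑[ v < n ] ⟦ ¬? (u ≟ᶠ v) ⟧ + ∑[ v < n ] ⟦ u ≟ᶠ v ⟧
        ≡⟨ sym (∑-distrib-+ (λ v → ⟦ ¬? (u ≟ᶠ v) ⟧) (λ v → ⟦ u ≟ᶠ v ⟧)) ⟩
      ∑[ v < n ] (⟦ ¬? (u ≟ᶠ v) ⟧ + ⟦ u ≟ᶠ v ⟧)
        ≡⟨ sum-cong-≗ (λ v → ⟦¬⟧+⟦⟧≡1 (u ≟ᶠ v)) ⟩
      ∑[ v < n ] 1
        ≡⟨ trans (sum-const n 1) (*-identityʳ n) ⟩
      n ∎
      where open ≡-Reasoning

    numBlocks*2e+n≡n*n : N * (e + e) + n ≡ n * n
    numBlocks*2e+n≡n*n = begin
      N * (e + e) + n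
        ≡⟨ cong (_+ n) (sym (trans (sum-cong-≗ λ b → count-edges (block S b)) (sum-const N (e + e)))) ⟩
      ∑[ b < N ] ∑[ u < n ] ∑[ v < n ] edge b u v + n
        ≡⟨ cong (_+ n) (trans (∑-comm (λ b u → ∑[ v < n ] edge b u v))
                              (sum-cong-≗ λ u → ∑-comm (λ b v → edge b u v))) ⟩
      ∑[ u < n ] ∑[ v < n ] ∑[ b < N ] edge b u v + n
        ≡⟨ cong₂ _+_ (sum-cong-≗ λ u → sum-cong-≗ λ v → count-blocks-through u v)
                     (sym (trans (sum-const n 1) (*-identityʳ n))) ⟩
      ∑[ u < n ] ∑[ v < n ] ⟦ ¬? (u ≟ᶠ v) ⟧ + ∑[ u < n ] 1
        ≡⟨ sym (∑-distrib-+ (λ u → ∑[ v < n ] ⟦ ¬? (u ≟ᶠ v) ⟧) (λ _ → 1)) ⟩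
      ∑[ u < n ] (∑[ v < n ] ⟦ ¬? (u ≟ᶠ v) ⟧ + 1)
        ≡⟨ sum-cong-≗ count-distinct ⟩
      ∑[ u < n ] n
        ≡⟨ sum-const n n ⟩
      n * n ∎
      where
      open ≡-Reasoning
      edge : Fin N → Fin n → Fin n → ℕ
      edge b u v = ⟦ hasEdge? (block S b) u v ⟧

    colourable-numBlocks : BlockColourable S N
    colourable-numBlocks = (λ b → b) , λ i j i≢j i≡j → ⊥-elim (i≢j i≡j)

    ¬colourable-below-numBlocks : (∀ i j → i ≢ j → ¬ Disjoint (block S i) (block S j)) →
                                  ∀ {k} → k < N → ¬ BlockColourable S k
    ¬colourable-below-numBlocks intersecting k<N (c , proper)
      with i , j , i<j , cᵢ≡cⱼ ← pigeonhole k<N c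
      = intersecting i j (<⇒≢ᶠ i<j) (proper i j (<⇒≢ᶠ i<j) cᵢ≡cⱼ)

  module _ {e : ℕ} (e≥1 : 1 ≤ e) (S : StarSystem (suc (e + e)) e) where

    numBlocks≡order : numBlocks S ≡ suc (e + e)
    numBlocks≡order = *-cancelʳ-≡ (numBlocks S) (suc (e + e)) (e + e) {{nonZero}}
      (+-cancelʳ-≡ (suc (e + e)) _ _ (trans (numBlocks*2e+n≡n*n S)
                                           (trans (*-suc (suc (e + e)) (e + e)) (+-comm (suc (e + e)) _))))
      where
      nonZero : NonZero (e + e)
      nonZero = >-nonZero (≤-trans e≥1 (m≤m+n e e))

    blockChromatic-order : BlockChromatic S (suc (e + e))
    blockChromatic-order = subst (BlockColourable S) numBlocks≡order (colourable-numBlocks S)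
                         , ¬colourable-below-numBlocks S intersecting (≤-reflexive (sym numBlocks≡order))
      where
      intersecting : ∀ i j → i ≢ j → ¬ Disjoint (block S i) (block S j)
      intersecting i j _ = ¬disjoint (≤-reflexive (sym (+-suc (suc e) e))) (block S i) (block S j)

  -- Block combine c r is the r-th star centred at c, whose leaves are the v with Leaf c r v.
  module FromLeafRelation {n e m : ℕ}
    (Leaf : Fin n → Fin m → Fin n → Set)
    (leaf? : ∀ c r v → Dec (Leaf c r v))
    (count-leaf : ∀ c r → ∑[ v < n ] ⟦ leaf? c r v ⟧ ≡ e)
    (leaf-irrefl : ∀ c r → ¬ Leaf c r c)
    (leaf-total : ∀ u v → u ≢ v → (∃ λ r → Leaf u r v) ⊎ (∃ λ r → Leaf v r u))
    (leaf-unique : ∀ u r r′ v → Leaf u r v → Leaf u r′ v → r ≡ r′)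
    (leaf-asym : ∀ u r v r′ → Leaf u r v → ¬ Leaf v r′ u)
    where

    leafSet : Fin n → Fin m → Subset n
    leafSet c r = tabulate (does ∘ leaf? c r)

    ∈leafSet⇒Leaf : ∀ {c r v} → v ∈ leafSet c r → Leaf c r v
    ∈leafSet⇒Leaf {c} {r} {v} v∈ =
      invert (subst (Reflects _) (trans (sym (lookup∘tabulate _ v)) ([]=⇒lookup v∈)) (proof (leaf? c r v)))

    Leaf⇒∈leafSet : ∀ {c r v} → Leaf c r v → v ∈ leafSet c r
    Leaf⇒∈leafSet {c} {r} {v} leaf = lookup⇒[]= v _ (trans (lookup∘tabulate _ v) (dec-true (leaf? c r v) leaf))

    star : Fin n → Fin m → Star n e
    star c r = record
      { centre     = c
      ; leaves     = leafSet c r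
      ; centre∉    = leaf-irrefl c r ∘ ∈leafSet⇒Leaf
      ; leavesCard = trans (∣tabulate∣≡count n (leaf? c r)) (count-leaf c r)
      }

    blockAt : Fin (n * m) → Star n e
    blockAt = uncurry star ∘ remQuot {n} m

    blockAt-combine : ∀ c r → blockAt (combine c r) ≡ star c r
    blockAt-combine c r = cong (uncurry star) (remQuot-combine c r)

    HasEdge⇒Leaf : ∀ {i u v} → HasEdge (blockAt i) u v →
                   (∃ λ r → combine u r ≡ i × Leaf u r v) ⊎ (∃ λ r → combine v r ≡ i × Leaf v r u)
    HasEdge⇒Leaf {i} (inj₁ (refl , v∈)) = inj₁ (_ , combine-remQuot {n} m i , ∈leafSet⇒Leaf v∈)
    HasEdge⇒Leaf {i} (inj₂ (refl , u∈)) = inj₂ (_ , combine-remQuot {n} m i , ∈leafSet⇒Leaf u∈)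

    partitionAt : ∀ u v → u ≢ v →
                  Σ (Fin (n * m)) λ i → HasEdge (blockAt i) u v × (∀ j → HasEdge (blockAt j) u v → j ≡ i)
    partitionAt u v u≢v with leaf-total u v u≢v
    ... | inj₁ (r , uv) =
      combine u r , subst (λ s → HasEdge s u v) (sym (blockAt-combine u r)) (inj₁ (refl , Leaf⇒∈leafSet uv)) , unique
      where
      unique : ∀ j → HasEdge (blockAt j) u v → j ≡ combine u r
      unique j edge with HasEdge⇒Leaf edge
      ... | inj₁ (r′ , refl , uv′) = cong (combine u) (leaf-unique u r′ r v uv′ uv)
      ... | inj₂ (_  , _    , vu′) = ⊥-elim (leaf-asym u r v _ uv vu′)
    ... | inj₂ (r , vu) =
      combine v r , subst (λ s → HasEdge s u v) (sym (blockAt-combine v r)) (inj₂ (refl , Leaf⇒∈leafSet vu)) , unique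
      where
      unique : ∀ j → HasEdge (blockAt j) u v → j ≡ combine v r
      unique j edge with HasEdge⇒Leaf edge
      ... | inj₁ (_  , _    , uv′) = ⊥-elim (leaf-asym v r u _ vu uv′)
      ... | inj₂ (r′ , refl , vu′) = cong (combine v) (leaf-unique v r′ r u vu′ vu)

    starSystem : StarSystem n e
    starSystem = record { numBlocks = n * m ; block = blockAt ; partition = partitionAt }

    InStar : Fin n → Fin m → Fin n → Set
    InStar c r v = c ≡ v ⊎ Leaf c r v

    blockColourable : ∀ K (colour : Fin n → Fin m → Fin K) →
      (∀ c r c′ r′ v → colour c r ≡ colour c′ r′ → InStar c r v → InStar c′ r′ v → c ≡ c′ × r ≡ r′) →
      BlockColourable starSystem K
    blockColourable K colour proper = uncurry colour ∘ remQuot {n} m , isColouring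
      where
      inStar : ∀ {i v} → HasVertex (blockAt i) v → InStar (proj₁ (remQuot {n} m i)) (proj₂ (remQuot {n} m i)) v
      inStar (inj₁ c≡v) = inj₁ c≡v
      inStar (inj₂ v∈)  = inj₂ (∈leafSet⇒Leaf v∈)
      isColouring : IsBlockColouring starSystem K (uncurry colour ∘ remQuot {n} m)
      isColouring i j i≢j same v (v∈i , v∈j) with proper _ _ _ _ v same (inStar v∈i) (inStar v∈j)
      ... | c≡c′ , r≡r′ = i≢j (begin
        i                                  ≡⟨ combine-remQuot {n} m i ⟨
        uncurry combine (remQuot {n} m i)  ≡⟨ cong₂ combine c≡c′ r≡r′ ⟩
        uncurry combine (remQuot {n} m j)  ≡⟨ combine-remQuot {n} m j ⟩
        j                                  ∎)
        where open ≡-Reasoning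

module Congruence where

  open import Data.Nat using (ℕ; zero; suc; _+_; _*_; _<_; z≤n; NonZero; pred)
  open import Data.Nat.Properties
  open import Data.Nat.DivMod
  open import Data.Nat.Tactic.RingSolver using (solve-∀)
  open import Level using (0ℓ)
  open import Relation.Binary using (Setoid; IsEquivalence)
  open import Relation.Binary.PropositionalEquality
  import Relation.Binary.Reasoning.Setoid
  open import Relation.Nullary using (¬_)

  module Modulo (m : ℕ) .{{_ : NonZero m}} where

    -- A record rather than a definition, so that a and b stay inferable from a ≡ₘ b.
    infix 4 _≡ₘ_
    record _≡ₘ_ (a b : ℕ) : Set where
      constructor residue-≡
      field residue : a % m ≡ b % m
    open _≡ₘ_ public

    ≡ₘ-isEquivalence : IsEquivalence _≡ₘ_
    ≡ₘ-isEquivalence = record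
      { refl  = residue-≡ refl
      ; sym   = λ a≡b → residue-≡ (sym (residue a≡b))
      ; trans = λ a≡b b≡c → residue-≡ (trans (residue a≡b) (residue b≡c))
      }

    ≡ₘ-setoid : Setoid 0ℓ 0ℓ
    ≡ₘ-setoid = record { isEquivalence = ≡ₘ-isEquivalence }

    open IsEquivalence ≡ₘ-isEquivalence public
      using () renaming (refl to ≡ₘ-refl; sym to ≡ₘ-sym; trans to ≡ₘ-trans)

    ≡⇒≡ₘ : ∀ {a b} → a ≡ b → a ≡ₘ b
    ≡⇒≡ₘ refl = ≡ₘ-refl

    +-congₘ : ∀ {a b c d} → a ≡ₘ b → c ≡ₘ d → a + c ≡ₘ b + d
    +-congₘ {a} {b} {c} {d} (residue-≡ a≡b) (residue-≡ c≡d) = residue-≡ (begin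
      (a + c) % m              ≡⟨ %-distribˡ-+ a c m ⟩
      (a % m + c % m) % m      ≡⟨ cong₂ (λ x y → (x + y) % m) a≡b c≡d ⟩
      (b % m + d % m) % m      ≡⟨ %-distribˡ-+ b d m ⟨
      (b + d) % m              ∎)
      where open ≡-Reasoning

    +-congˡₘ : ∀ a {b c} → b ≡ₘ c → a + b ≡ₘ a + c
    +-congˡₘ a = +-congₘ ≡ₘ-refl

    +-congʳₘ : ∀ a {b c} → b ≡ₘ c → b + a ≡ₘ c + a
    +-congʳₘ a b≡c = +-congₘ b≡c ≡ₘ-refl

    *-congˡₘ : ∀ c {a b} → a ≡ₘ b → c * a ≡ₘ c * b
    *-congˡₘ zero    a≡b = ≡ₘ-refl
    *-congˡₘ (suc c) a≡b = +-congₘ a≡b (*-congˡₘ c a≡b)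

    +*m≡ₘ : ∀ a b → a + b * m ≡ₘ a
    +*m≡ₘ a b = residue-≡ ([m+kn]%n≡m%n a b m)

    module ≡ₘ-Reasoning = Relation.Binary.Reasoning.Setoid ≡ₘ-setoid

    -- Adding (m − 1) · a undoes adding a.
    +-cancelˡₘ : ∀ a {b c} → a + b ≡ₘ a + c → b ≡ₘ c
    +-cancelˡₘ a {b} {c} a+b≡a+c = begin
      b                         ≈⟨ +*m≡ₘ b a ⟨
      b + a * m                 ≡⟨ rearrange b ⟩
      a * pred m + (a + b)      ≈⟨ +-congˡₘ (a * pred m) a+b≡a+c ⟩
      a * pred m + (a + c)      ≡⟨ rearrange c ⟨
      c + a * m                 ≈⟨ +*m≡ₘ c a ⟩
      c                         ∎
      where
      open ≡ₘ-Reasoning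
      lemma : ∀ x a p → x + a * suc p ≡ a * p + (a + x)
      lemma = solve-∀
      rearrange : ∀ x → x + a * m ≡ a * pred m + (a + x)
      rearrange x = trans (cong (λ y → x + a * y) (sym (suc-pred m))) (lemma x a (pred m))

    +-cancelʳₘ : ∀ a {b c} → b + a ≡ₘ c + a → b ≡ₘ c
    +-cancelʳₘ a {b} {c} b+a≡c+a =
      +-cancelˡₘ a (≡ₘ-trans (≡⇒≡ₘ (+-comm a b)) (≡ₘ-trans b+a≡c+a (≡⇒≡ₘ (+-comm c a))))

    ≡ₘ⇒≡ : ∀ {a b} → a < m → b < m → a ≡ₘ b → a ≡ b
    ≡ₘ⇒≡ a<m b<m (residue-≡ a≡b) = trans (sym (m<n⇒m%n≡m a<m)) (trans a≡b (m<n⇒m%n≡m b<m))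

    ≢ₘ0 : ∀ {a} → 0 < a → a < m → ¬ a ≡ₘ 0
    ≢ₘ0 0<a a<m a≡0 = <⇒≢ 0<a (sym (≡ₘ⇒≡ a<m (≤-<-trans z≤n a<m) a≡0))

  module _ (k : ℕ) where

    open Modulo (suc (k + k))

    -- (k + 1) · 2 ≡ 1 modulo 2k + 1.
    double-cancelₘ : ∀ {a b} → a + a ≡ₘ b + b → a ≡ₘ b
    double-cancelₘ {a} {b} 2a≡2b = begin
      a                          ≈⟨ +*m≡ₘ a a ⟨
      a + a * suc (k + k)        ≡⟨ halve a k ⟩
      suc k * (a + a)            ≈⟨ *-congˡₘ (suc k) 2a≡2b ⟩
      suc k * (b + b)            ≡⟨ halve b k ⟨
      b + b * suc (k + k)        ≈⟨ +*m≡ₘ b b ⟩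
      b                          ∎
      where
      open ≡ₘ-Reasoning
      halve : ∀ x k → x + x * suc (k + k) ≡ suc k * (x + x)
      halve = solve-∀

module Construction (e k : ℕ) (e≥3 : 3 ≤ e) (k≥1 : 1 ≤ k) where

  open import Defs using (StarSystem; BlockColourable)
  open Counting
  open StarSystems using (module FromLeafRelation)
  open Congruence
  open import Data.Nat using (ℕ; zero; suc; _+_; _*_; _∸_; _≤_; _<_; z≤n; s≤s; _≤?_; _<?_; NonZero; >-nonZero)
    renaming (_≟_ to _≟ⁿ_)
  open import Data.Nat.Properties
  open import Data.Nat.DivMod using (_mod_; _%_; m%n<n; m%n%n≡m%n)
  open import Data.Fin using (Fin; zero; suc; toℕ; fromℕ<; combine; remQuot; splitAt; join; _↑ˡ_; _↑ʳ_)
  open import Data.Fin.Properties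
    using (toℕ<n; toℕ-fromℕ<; toℕ-injective; remQuot-combine; combine-remQuot; combine-injective;
           splitAt-join; join-splitAt)
    renaming (_≟_ to _≟ᶠ_)
  open import Data.Product using (Σ; ∃; ∃₂; _×_; _,_; proj₁; proj₂; uncurry)
  open import Data.Unit using (⊤; tt)
  open import Data.Sum using (_⊎_; inj₁; inj₂; swap) renaming (map to map⊎)
  open import Data.Empty using (⊥; ⊥-elim)
  open import Function using (_∘_)
  open import Relation.Nullary using (¬_; Dec; yes; no)
  open import Relation.Nullary.Decidable using (_×-dec_; _⊎-dec_; map′)
  open import Relation.Binary.PropositionalEquality
  open import Relation.Binary using (tri<; tri≈; tri>)

  m : ℕ
  m = suc (k + k)

  open Modulo m

  data Point : Set where
    ∞     : Point
    ⟨_,_⟩ : Fin m → Fin (e + e) → Point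

  n : ℕ
  n = suc (m * (e + e))

  decode : Fin n → Point
  decode zero    = ∞
  decode (suc w) = uncurry ⟨_,_⟩ (remQuot (e + e) w)

  encode : Point → Fin n
  encode ∞         = zero
  encode ⟨ s , q ⟩ = suc (combine s q)

  encode∘decode : ∀ v → encode (decode v) ≡ v
  encode∘decode zero    = refl
  encode∘decode (suc w) = cong suc (combine-remQuot {m} (e + e) w)

  decode∘encode : ∀ x → decode (encode x) ≡ x
  decode∘encode ∞         = refl
  decode∘encode ⟨ s , q ⟩ = cong (uncurry ⟨_,_⟩) (remQuot-combine s q)

  decode-injective : ∀ {u v} → decode u ≡ decode v → u ≡ v
  decode-injective {u} {v} eq = trans (sym (encode∘decode u)) (trans (cong encode eq) (encode∘decode v))

  sum-decode : (f : Point → ℕ) → ∑[ v < n ] f (decode v) ≡ f ∞ + ∑[ s < m ] ∑[ q < e + e ] f ⟨ s , q ⟩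
  sum-decode f = cong (f ∞ +_) (trans (sum-combine m (e + e) (f ∘ decode ∘ suc))
                                      (sum-cong-≗ λ s → sum-cong-≗ λ q → cong f (decode∘encode ⟨ s , q ⟩)))

  data Side : Set where
    low high : Side

  data StarIndex : Set where
    internal : StarIndex
    cross    : Side → Fin k → StarIndex

  index : Fin m → StarIndex
  index zero    = internal
  index (suc j) with splitAt k j
  ... | inj₁ δ = cross low δ
  ... | inj₂ δ = cross high δ

  fromIndex : StarIndex → Fin m
  fromIndex internal       = zero
  fromIndex (cross low δ)  = suc (δ ↑ˡ k)
  fromIndex (cross high δ) = suc (k ↑ʳ δ)

  index∘fromIndex : ∀ i → index (fromIndex i) ≡ i
  index∘fromIndex internal       = refl
  index∘fromIndex (cross low δ)  rewrite splitAt-join k k (inj₁ δ) = refl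
  index∘fromIndex (cross high δ) rewrite splitAt-join k k (inj₂ δ) = refl

  fromIndex∘index : ∀ r → fromIndex (index r) ≡ r
  fromIndex∘index zero    = refl
  fromIndex∘index (suc j) with splitAt k j in eq
  ... | inj₁ δ = cong suc (trans (cong (join k k) (sym eq)) (join-splitAt k k j))
  ... | inj₂ δ = cong suc (trans (cong (join k k) (sym eq)) (join-splitAt k k j))

  index-injective : ∀ {r r′} → index r ≡ index r′ → r ≡ r′
  index-injective {r} {r′} eq = trans (sym (fromIndex∘index r)) (trans (cong fromIndex eq) (fromIndex∘index r′))

  -- q′ is among the e successors of q in ℤ₂ₑ; an antipodal pair is oriented from its lower point.
  Ahead : ℕ → ℕ → Set
  Ahead q q′ = (q < q′ × q′ ≤ q + e) ⊎ (q′ + e < q)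

  ahead? : ∀ q q′ → Dec (Ahead q q′)
  ahead? q q′ = ((q <? q′) ×-dec (q′ ≤? q + e)) ⊎-dec (q′ + e <? q)

  OnSide : Side → ℕ → Set
  OnSide low  q = q < e
  OnSide high q = e ≤ q

  onSide? : ∀ σ q → Dec (OnSide σ q)
  onSide? low  q = q <? e
  onSide? high q = e ≤? q

  distance : Fin k → ℕ
  distance δ = suc (toℕ δ)

  Step : Fin m → Fin k → Fin m → Set
  Step s δ t = toℕ t ≡ₘ toℕ s + distance δ

  step? : ∀ s δ t → Dec (Step s δ t)
  step? s δ t = map′ residue-≡ residue (toℕ t % m ≟ⁿ (toℕ s + distance δ) % m)

  LeafOf∞ : Fin m → Point → Set
  LeafOf∞ r ∞          = ⊥
  LeafOf∞ r ⟨ t , q′ ⟩ = r ≡ t × toℕ q′ < e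

  LeafOf : Fin m → Fin (e + e) → StarIndex → Point → Set
  LeafOf s q internal    ∞          = e ≤ toℕ q
  LeafOf s q internal    ⟨ t , q′ ⟩ = s ≡ t × Ahead (toℕ q) (toℕ q′)
  LeafOf s q (cross σ δ) ∞          = ⊥
  LeafOf s q (cross σ δ) ⟨ t , q′ ⟩ = Step s δ t × OnSide σ (toℕ q′)


  leafOf∞? : ∀ r y → Dec (LeafOf∞ r y)
  leafOf∞? r ∞          = no λ ()
  leafOf∞? r ⟨ t , q′ ⟩ = (r ≟ᶠ t) ×-dec (toℕ q′ <? e)

  leafOf? : ∀ s q i y → Dec (LeafOf s q i y)
  leafOf? s q internal    ∞          = e ≤? toℕ q
  leafOf? s q internal    ⟨ t , q′ ⟩ = (s ≟ᶠ t) ×-dec ahead? (toℕ q) (toℕ q′)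
  leafOf? s q (cross σ δ) ∞          = no λ ()
  leafOf? s q (cross σ δ) ⟨ t , q′ ⟩ = step? s δ t ×-dec onSide? σ (toℕ q′)

  data Block : Set where
    at∞ : Fin m → Block
    at  : Fin m → Fin (e + e) → StarIndex → Block

  toBlock : Point → Fin m → Block
  toBlock ∞         r = at∞ r
  toBlock ⟨ s , q ⟩ r = at s q (index r)

  at-injective : ∀ {s q i s′ q′ i′} → at s q i ≡ at s′ q′ i′ → s ≡ s′ × q ≡ q′ × i ≡ i′
  at-injective refl = refl , refl , refl

  toBlock-injective : ∀ x r x′ r′ → toBlock x r ≡ toBlock x′ r′ → x ≡ x′ × r ≡ r′
  toBlock-injective ∞         r ∞           r′ refl = refl , refl
  toBlock-injective ⟨ s , q ⟩ r ⟨ s′ , q′ ⟩ r′ eq with at-injective eq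
  ... | refl , refl , same-index = refl , index-injective same-index

  centreOf : Block → Point
  centreOf (at∞ _)    = ∞
  centreOf (at s q _) = ⟨ s , q ⟩

  BlockLeaf : Block → Point → Set
  BlockLeaf (at∞ r)    = LeafOf∞ r
  BlockLeaf (at s q i) = LeafOf s q i

  Incident : Block → Point → Set
  Incident b y = centreOf b ≡ y ⊎ BlockLeaf b y

  Leaf : Point → Fin m → Point → Set
  Leaf x r = BlockLeaf (toBlock x r)

  blockLeaf? : ∀ b y → Dec (BlockLeaf b y)
  blockLeaf? (at∞ r)    = leafOf∞? r
  blockLeaf? (at s q i) = leafOf? s q i

  leaf? : ∀ x r y → Dec (Leaf x r y)
  leaf? x r = blockLeaf? (toBlock x r)

  count-ahead-low : ∀ q → q < e → ∑[ q′ < e + e ] ⟦ ahead? q (toℕ q′) ⟧ ≡ e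
  count-ahead-low q q<e = begin
    ∑[ q′ < e + e ] ⟦ ahead? q (toℕ q′) ⟧
      ≡⟨ count-cong (e + e) (λ q′ → ahead? q (toℕ q′)) (λ q′ → inRange? (suc q) (suc (q + e)) (toℕ q′))
           (λ _ → forward) (λ _ (q<q′ , q′≤q+e) → inj₁ (q<q′ , ≤-pred q′≤q+e)) ⟩
    ∑[ q′ < e + e ] ⟦ inRange? (suc q) (suc (q + e)) (toℕ q′) ⟧
      ≡⟨ count-range (e + e) (suc q) (suc (q + e)) (+-monoˡ-≤ e q<e) ⟩
    q + e ∸ q
      ≡⟨ m+n∸m≡n q e ⟩
    e ∎
    where
    open ≡-Reasoning
    forward : ∀ {q′} → Ahead q q′ → InRange (suc q) (suc (q + e)) q′
    forward (inj₁ (q<q′ , q′≤q+e)) = q<q′ , s≤s q′≤q+e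
    forward {q′} (inj₂ q′+e<q)      = ⊥-elim (<⇒≱ q<e (≤-trans (m≤n+m e q′) (<⇒≤ q′+e<q)))

  count-ahead-high : ∀ a → a < e → suc (∑[ q′ < e + e ] ⟦ ahead? (e + a) (toℕ q′) ⟧) ≡ e
  count-ahead-high a a<e = begin
    suc (∑[ q′ < e + e ] ⟦ ahead? (e + a) (toℕ q′) ⟧)
      ≡⟨ cong suc count ⟩
    suc (e ∸ suc a + a)
      ≡⟨ +-suc (e ∸ suc a) a ⟨
    e ∸ suc a + suc a
      ≡⟨ m∸n+n≡m a<e ⟩
    e ∎
    where
    open ≡-Reasoning
    later? earlier? : ∀ q′ → Dec _
    later? q′ = ((e + a) <? toℕ q′) ×-dec (toℕ q′ ≤? e + a + e)
    earlier? q′ = toℕ q′ + e <? e + a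
    count : ∑[ q′ < e + e ] ⟦ ahead? (e + a) (toℕ q′) ⟧ ≡ e ∸ suc a + a
    count = begin
      ∑[ q′ < e + e ] ⟦ ahead? (e + a) (toℕ q′) ⟧
        ≡⟨ sum-cong-≗ (λ q′ → ⟦⟧-⊎ (later? q′) (earlier? q′)
                         λ ((q<q′ , _) , q′+e<q) → <-asym q<q′ (≤-<-trans (m≤m+n _ e) q′+e<q)) ⟩
      ∑[ q′ < e + e ] (⟦ later? q′ ⟧ + ⟦ earlier? q′ ⟧)
        ≡⟨ ∑-distrib-+ (λ q′ → ⟦ later? q′ ⟧) (λ q′ → ⟦ earlier? q′ ⟧) ⟩
      ∑[ q′ < e + e ] ⟦ later? q′ ⟧ + ∑[ q′ < e + e ] ⟦ earlier? q′ ⟧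
        ≡⟨ cong₂ _+_ (trans (count-cong (e + e) later? (λ q′ → inRange? (suc (e + a)) (e + e) (toℕ q′))
                                (λ q′ (q<q′ , _) → q<q′ , toℕ<n q′)
                                (λ q′ (q<q′ , _) → q<q′ , <⇒≤ (<-≤-trans (toℕ<n q′) (+-monoˡ-≤ e (m≤m+n e a)))))
                            (count-range (e + e) (suc (e + a)) (e + e) ≤-refl))
                     (trans (count-cong (e + e) earlier? (λ q′ → inRange? 0 a (toℕ q′))
                                (λ q′ q′+e<q → z≤n , +-cancelʳ-< e _ a (subst (toℕ q′ + e <_) (+-comm e a) q′+e<q))
                                (λ q′ (_ , q′<a) → subst (toℕ q′ + e <_) (+-comm a e) (+-monoˡ-< e q′<a)))
                            (count-range (e + e) 0 a (≤-trans (<⇒≤ a<e) (m≤m+n e e)))) ⟩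
      (e + e) ∸ suc (e + a) + a
        ≡⟨ cong (_+ a) (trans (cong ((e + e) ∸_) (sym (+-suc e a))) ([m+n]∸[m+o]≡n∸o e e (suc a))) ⟩
      e ∸ suc a + a
        ∎

  count-ahead : ∀ q → q < e + e → ⟦ e ≤? q ⟧ + ∑[ q′ < e + e ] ⟦ ahead? q (toℕ q′) ⟧ ≡ e
  count-ahead q q<2e with <-≤-connex q e
  ... | inj₁ q<e = trans (cong (_+ ∑[ q′ < e + e ] ⟦ ahead? q (toℕ q′) ⟧) (⟦⟧-no (<⇒≱ q<e) (e ≤? q)))
                         (count-ahead-low q q<e)
  ... | inj₂ e≤q with m≤n⇒∃[o]m+o≡n e≤q
  ...   | a , refl = trans (cong (_+ ∑[ q′ < e + e ] ⟦ ahead? (e + a) (toℕ q′) ⟧) (⟦⟧-yes e≤q (e ≤? e + a)))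
                           (count-ahead-high a (+-cancelˡ-< e a e q<2e))

  count-onSide : ∀ σ → ∑[ q′ < e + e ] ⟦ onSide? σ (toℕ q′) ⟧ ≡ e
  count-onSide low  =
    trans (count-cong (e + e) (λ q′ → onSide? low (toℕ q′)) (λ q′ → inRange? 0 e (toℕ q′))
                      (λ _ q′<e → z≤n , q′<e) (λ _ → proj₂))
          (count-range (e + e) 0 e (m≤m+n e e))
  count-onSide high =
    trans (count-cong (e + e) (λ q′ → onSide? high (toℕ q′)) (λ q′ → inRange? e (e + e) (toℕ q′))
                      (λ q′ e≤q′ → e≤q′ , toℕ<n q′) (λ _ → proj₁))
          (trans (count-range (e + e) e (e + e) ≤-refl) (m+n∸m≡n e e))

  count-step : ∀ s δ → ∑[ t < m ] ⟦ step? s δ t ⟧ ≡ 1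
  count-step s δ = count-unique m (step? s δ) target target-step unique
    where
    x = toℕ s + distance δ
    target : Fin m
    target = x mod m
    target-step : Step s δ target
    target-step = residue-≡ (trans (cong (_% m) (toℕ-fromℕ< (m%n<n x m))) (m%n%n≡m%n x m))
    unique : ∀ t → Step s δ t → t ≡ target
    unique t t-step = toℕ-injective (≡ₘ⇒≡ (toℕ<n t) (toℕ<n target) (≡ₘ-trans t-step (≡ₘ-sym target-step)))

  count-leaf : ∀ x r → ∑[ v < n ] ⟦ leaf? x r (decode v) ⟧ ≡ e
  count-leaf x r = trans (sum-decode (⟦_⟧ ∘ blockLeaf? (toBlock x r))) (count (toBlock x r))
    where
    open ≡-Reasoning
    count : ∀ b → ⟦ blockLeaf? b ∞ ⟧ + ∑[ t < m ] ∑[ q′ < e + e ] ⟦ blockLeaf? b ⟨ t , q′ ⟩ ⟧ ≡ e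
    count (at∞ r) = begin
      ∑[ t < m ] ∑[ q′ < e + e ] ⟦ (r ≟ᶠ t) ×-dec (toℕ q′ <? e) ⟧
        ≡⟨ count-× m (e + e) (r ≟ᶠ_) (λ q′ → toℕ q′ <? e) ⟩
      ∑[ t < m ] ⟦ r ≟ᶠ t ⟧ * ∑[ q′ < e + e ] ⟦ toℕ q′ <? e ⟧
        ≡⟨ cong₂ _*_ (count-≟ m r) (count-onSide low) ⟩
      1 * e
        ≡⟨ *-identityˡ e ⟩
      e ∎
    count (at s q internal) = begin
      ⟦ e ≤? toℕ q ⟧ + ∑[ t < m ] ∑[ q′ < e + e ] ⟦ (s ≟ᶠ t) ×-dec ahead? (toℕ q) (toℕ q′) ⟧
        ≡⟨ cong (⟦ e ≤? toℕ q ⟧ +_) (count-× m (e + e) (s ≟ᶠ_) (λ q′ → ahead? (toℕ q) (toℕ q′))) ⟩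
      ⟦ e ≤? toℕ q ⟧ + ∑[ t < m ] ⟦ s ≟ᶠ t ⟧ * ∑[ q′ < e + e ] ⟦ ahead? (toℕ q) (toℕ q′) ⟧
        ≡⟨ cong (λ c → ⟦ e ≤? toℕ q ⟧ + c * ∑[ q′ < e + e ] ⟦ ahead? (toℕ q) (toℕ q′) ⟧) (count-≟ m s) ⟩
      ⟦ e ≤? toℕ q ⟧ + 1 * ∑[ q′ < e + e ] ⟦ ahead? (toℕ q) (toℕ q′) ⟧
        ≡⟨ cong (⟦ e ≤? toℕ q ⟧ +_) (*-identityˡ (∑[ q′ < e + e ] ⟦ ahead? (toℕ q) (toℕ q′) ⟧)) ⟩
      ⟦ e ≤? toℕ q ⟧ + ∑[ q′ < e + e ] ⟦ ahead? (toℕ q) (toℕ q′) ⟧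
        ≡⟨ count-ahead (toℕ q) (toℕ<n q) ⟩
      e ∎
    count (at s q (cross σ δ)) = begin
      ∑[ t < m ] ∑[ q′ < e + e ] ⟦ step? s δ t ×-dec onSide? σ (toℕ q′) ⟧
        ≡⟨ count-× m (e + e) (step? s δ) (λ q′ → onSide? σ (toℕ q′)) ⟩
      ∑[ t < m ] ⟦ step? s δ t ⟧ * ∑[ q′ < e + e ] ⟦ onSide? σ (toℕ q′) ⟧
        ≡⟨ cong₂ _*_ (count-step s δ) (count-onSide σ) ⟩
      1 * e
        ≡⟨ *-identityˡ e ⟩
      e ∎

  0<distance : ∀ δ → 0 < distance δ
  0<distance δ = s≤s z≤n

  distance≤k : ∀ δ → distance δ ≤ k
  distance≤k δ = toℕ<n δ

  distance<m : ∀ δ → distance δ < m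
  distance<m δ = s≤s (≤-trans (distance≤k δ) (m≤m+n k k))

  distance-injective : ∀ {δ δ′} → distance δ ≡ distance δ′ → δ ≡ δ′
  distance-injective = toℕ-injective ∘ suc-injective

  fromDistance : ∀ d → 0 < d → d ≤ k → ∃ λ δ → distance δ ≡ d
  fromDistance (suc d) _ d<k = fromℕ< d<k , cong suc (toℕ-fromℕ< d<k)

  shift≢ₘ : ∀ a {x} → 0 < x → x < m → ¬ a + x ≡ₘ a
  shift≢ₘ a 0<x x<m a+x≡a = ≢ₘ0 0<x x<m (+-cancelˡₘ a (≡ₘ-trans a+x≡a (≡⇒≡ₘ (sym (+-identityʳ a)))))

  step-irrefl : ∀ s δ → ¬ Step s δ s
  step-irrefl s δ s≡s+d = shift≢ₘ (toℕ s) (0<distance δ) (distance<m δ) (≡ₘ-sym s≡s+d)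

  step-asym : ∀ {s t} δ δ′ → Step s δ t → ¬ Step t δ′ s
  step-asym {s} {t} δ δ′ t≡s+d s≡t+d′ =
    shift≢ₘ (toℕ t) (≤-trans (0<distance δ′) (m≤m+n _ _)) d′+d<m (begin
      toℕ t + (distance δ′ + distance δ)   ≡⟨ +-assoc (toℕ t) _ _ ⟨
      toℕ t + distance δ′ + distance δ     ≈⟨ +-congʳₘ (distance δ) s≡t+d′ ⟨
      toℕ s + distance δ                   ≈⟨ t≡s+d ⟨
      toℕ t                                ∎)
    where
    open ≡ₘ-Reasoning
    d′+d<m : distance δ′ + distance δ < m
    d′+d<m = s≤s (+-mono-≤ (distance≤k δ′) (distance≤k δ))

  step-injective : ∀ {s t} δ δ′ → Step s δ t → Step s δ′ t → δ ≡ δ′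
  step-injective {s} δ δ′ t≡s+d t≡s+d′ = distance-injective
    (≡ₘ⇒≡ (distance<m δ) (distance<m δ′) (+-cancelˡₘ (toℕ s) (≡ₘ-trans (≡ₘ-sym t≡s+d) t≡s+d′)))

  far⇒complement-near : ∀ d → d < m → k < d → 0 < m ∸ d × m ∸ d ≤ k
  far⇒complement-near d d<m k<d = m<n⇒0<n∸m d<m , (begin
    m ∸ d              ≤⟨ ∸-monoʳ-≤ m k<d ⟩
    m ∸ suc k          ≡⟨ m+n∸m≡n k k ⟩
    k                  ∎)
    where open ≤-Reasoning

  step-total-< : ∀ a b → a < b → b < m →
    (∃ λ δ → b ≡ₘ a + distance δ) ⊎ (∃ λ δ → a ≡ₘ b + distance δ)
  step-total-< a b a<b b<m with b ∸ a ≤? k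
  ... | yes d≤k = let δ , distance≡d = fromDistance (b ∸ a) (m<n⇒0<n∸m a<b) d≤k in
    inj₁ (δ , ≡⇒≡ₘ (trans (sym (m+[n∸m]≡n (<⇒≤ a<b))) (cong (a +_) (sym distance≡d))))
  ... | no  d≰k = let 0<d′ , d′≤k = far⇒complement-near (b ∸ a) d<m (≰⇒> d≰k)
                      δ , distance≡d′ = fromDistance (m ∸ (b ∸ a)) 0<d′ d′≤k in
    inj₂ (δ , (begin
      a                                ≈⟨ +*m≡ₘ a 1 ⟨
      a + 1 * m                        ≡⟨ cong (a +_) (trans (*-identityˡ m) (sym (m+[n∸m]≡n (<⇒≤ d<m)))) ⟩
      a + ((b ∸ a) + (m ∸ (b ∸ a)))    ≡⟨ +-assoc a (b ∸ a) _ ⟨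
      a + (b ∸ a) + (m ∸ (b ∸ a))      ≡⟨ cong₂ _+_ (m+[n∸m]≡n (<⇒≤ a<b)) (sym distance≡d′) ⟩
      b + distance δ                   ∎))
    where
    open ≡ₘ-Reasoning
    d<m : b ∸ a < m
    d<m = ≤-<-trans (m∸n≤m b a) b<m

  step-total : ∀ s t → s ≢ t → (∃ λ δ → Step s δ t) ⊎ (∃ λ δ → Step t δ s)
  step-total s t s≢t with <-cmp (toℕ s) (toℕ t)
  ... | tri< s<t _ _ = step-total-< (toℕ s) (toℕ t) s<t (toℕ<n t)
  ... | tri≈ _ s≡t _ = ⊥-elim (s≢t (toℕ-injective s≡t))
  ... | tri> _ _ t<s = swap (step-total-< (toℕ t) (toℕ s) t<s (toℕ<n s))

  ahead-irrefl : ∀ q → ¬ Ahead q q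
  ahead-irrefl q (inj₁ (q<q , _)) = <-irrefl refl q<q
  ahead-irrefl q (inj₂ q+e<q)     = <⇒≱ q+e<q (m≤m+n q e)

  ahead-asym : ∀ {q q′} → Ahead q q′ → ¬ Ahead q′ q
  ahead-asym (inj₁ (q<q′ , _))       (inj₁ (q′<q , _))       = <-asym q<q′ q′<q
  ahead-asym (inj₁ (_ , q′≤q+e))     (inj₂ q+e<q′)           = <⇒≱ q+e<q′ q′≤q+e
  ahead-asym (inj₂ q′+e<q)           (inj₁ (_ , q≤q′+e))     = <⇒≱ q′+e<q q≤q′+e
  ahead-asym {q} {q′} (inj₂ q′+e<q)  (inj₂ q+e<q′)           =
    <-asym (≤-<-trans (m≤m+n q′ e) q′+e<q) (≤-<-trans (m≤m+n q e) q+e<q′)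

  ahead-total-< : ∀ {q q′} → q < q′ → Ahead q q′ ⊎ Ahead q′ q
  ahead-total-< {q} {q′} q<q′ with q′ ≤? q + e
  ... | yes q′≤q+e = inj₁ (inj₁ (q<q′ , q′≤q+e))
  ... | no  q′≰q+e = inj₂ (inj₂ (≰⇒> q′≰q+e))

  ahead-total : ∀ {q q′} → q ≢ q′ → Ahead q q′ ⊎ Ahead q′ q
  ahead-total {q} {q′} q≢q′ with <-cmp q q′
  ... | tri< q<q′ _ _ = ahead-total-< q<q′
  ... | tri≈ _ q≡q′ _ = ⊥-elim (q≢q′ q≡q′)
  ... | tri> _ _ q′<q = swap (ahead-total-< q′<q)

  onSide-unique : ∀ {σ σ′ q} → OnSide σ q → OnSide σ′ q → σ ≡ σ′
  onSide-unique {low}  {low}  _   _   = refl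
  onSide-unique {low}  {high} q<e e≤q = ⊥-elim (<⇒≱ q<e e≤q)
  onSide-unique {high} {low}  e≤q q<e = ⊥-elim (<⇒≱ q<e e≤q)
  onSide-unique {high} {high} _   _   = refl

  onSide-total : ∀ q → ∃ λ σ → OnSide σ q
  onSide-total q with q <? e
  ... | yes q<e = low , q<e
  ... | no  q≮e = high , ≮⇒≥ q≮e

  leafOf-irrefl : ∀ s q i → ¬ LeafOf s q i ⟨ s , q ⟩
  leafOf-irrefl s q internal    (_ , q-ahead-q) = ahead-irrefl (toℕ q) q-ahead-q
  leafOf-irrefl s q (cross σ δ) (s-step-s , _)  = step-irrefl s δ s-step-s

  leaf-irrefl : ∀ x r → ¬ Leaf x r x
  leaf-irrefl ∞         r ()
  leaf-irrefl ⟨ s , q ⟩ r = leafOf-irrefl s q (index r)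

  leafOf-unique : ∀ s q i i′ y → LeafOf s q i y → LeafOf s q i′ y → i ≡ i′
  leafOf-unique s q internal    internal      y          _             _               = refl
  leafOf-unique s q internal    (cross σ′ δ′) ⟨ t , q′ ⟩ (refl , _)    (step , _)      = ⊥-elim (step-irrefl s δ′ step)
  leafOf-unique s q (cross σ δ) internal      ⟨ t , q′ ⟩ (step , _)    (refl , _)      = ⊥-elim (step-irrefl s δ step)
  leafOf-unique s q (cross σ δ) (cross σ′ δ′) ⟨ t , q′ ⟩ (step , side) (step′ , side′) =
    cong₂ cross (onSide-unique side side′) (step-injective δ δ′ step step′)

  leaf-unique : ∀ x r r′ y → Leaf x r y → Leaf x r′ y → r ≡ r′
  leaf-unique ∞         r r′ ⟨ t , q′ ⟩ (r≡t , _) (r′≡t , _) = trans r≡t (sym r′≡t)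
  leaf-unique ⟨ s , q ⟩ r r′ y leaf leaf′ = index-injective (leafOf-unique s q (index r) (index r′) y leaf leaf′)

  leafOf-asym : ∀ s q i t q′ i′ → LeafOf s q i ⟨ t , q′ ⟩ → ¬ LeafOf t q′ i′ ⟨ s , q ⟩
  leafOf-asym s q internal    t q′ internal      (_ , ahead)     (_ , ahead′)  = ahead-asym ahead ahead′
  leafOf-asym s q internal    t q′ (cross σ′ δ′) (refl , _)      (step′ , _)   = step-irrefl s δ′ step′
  leafOf-asym s q (cross σ δ) t q′ internal      (step , _)      (refl , _)    = step-irrefl s δ step
  leafOf-asym s q (cross σ δ) t q′ (cross σ′ δ′) (step , _)      (step′ , _)   = step-asym δ δ′ step step′

  leaf-asym : ∀ x r y r′ → Leaf x r y → ¬ Leaf y r′ x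
  leaf-asym ∞         r ⟨ t , q′ ⟩ r′ (_ , q′<e) leaf′ with index r′
  ... | internal = <⇒≱ q′<e leaf′
  leaf-asym ⟨ s , q ⟩ r ∞ r′ leaf (_ , q<e) with index r
  ... | internal = <⇒≱ q<e leaf
  leaf-asym ⟨ s , q ⟩ r ⟨ t , q′ ⟩ r′ = leafOf-asym s q (index r) t q′ (index r′)

  leafAt : ∀ {s q y} i → LeafOf s q i y → ∃ λ r → Leaf ⟨ s , q ⟩ r y
  leafAt {s} {q} {y} i leaf = fromIndex i , subst (λ j → LeafOf s q j y) (sym (index∘fromIndex i)) leaf

  leaf-total : ∀ x y → x ≢ y → (∃ λ r → Leaf x r y) ⊎ (∃ λ r → Leaf y r x)
  leaf-total ∞ ∞ ∞≢∞ = ⊥-elim (∞≢∞ refl)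
  leaf-total ∞ ⟨ t , q′ ⟩ _ with toℕ q′ <? e
  ... | yes q′<e = inj₁ (t , refl , q′<e)
  ... | no  q′≮e = inj₂ (zero , ≮⇒≥ q′≮e)
  leaf-total ⟨ s , q ⟩ ∞ _ with toℕ q <? e
  ... | yes q<e = inj₂ (s , refl , q<e)
  ... | no  q≮e = inj₁ (zero , ≮⇒≥ q≮e)
  leaf-total ⟨ s , q ⟩ ⟨ t , q′ ⟩ x≢y with s ≟ᶠ t
  ... | yes refl = map⊎ (λ ahead → zero , refl , ahead) (λ ahead → zero , refl , ahead)
                     (ahead-total λ q≡q′ → x≢y (cong ⟨ s ,_⟩ (toℕ-injective q≡q′)))
  ... | no  s≢t with step-total s t s≢t
  ...   | inj₁ (δ , step) = let σ , side = onSide-total (toℕ q′) in inj₁ (leafAt (cross σ δ) (step , side))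
  ...   | inj₂ (δ , step) = let σ , side = onSide-total (toℕ q) in inj₂ (leafAt (cross σ δ) (step , side))


  instance
    e+e-nonZero : NonZero (e + e)
    e+e-nonZero = >-nonZero (≤-trans (s≤s z≤n) (≤-trans e≥3 (m≤m+n e e)))

  open Modulo (e + e) using ()
    renaming (_≡ₘ_ to _≡ᵣ_; residue-≡ to residue-≡ᵣ; ≡ₘ-sym to ≡ᵣ-sym; ≡ₘ⇒≡ to ≡ᵣ⇒≡; ≢ₘ0 to ≢ᵣ0;
              +-cancelˡₘ to +-cancelˡᵣ; +-cancelʳₘ to +-cancelʳᵣ)

  Colour : Set
  Colour = ℕ × ℕ

  SameColour : Colour → Colour → Set
  SameColour (a , b) (a′ , b′) = a ≡ₘ a′ × b ≡ᵣ b′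

  bit : Side → ℕ
  bit low  = 0
  bit high = 1

  -- (2s, 1) is the colour of the star at ∞ onto group s, which contains the centre (s, 1).
  internalColour : ℕ → (q : ℕ) → Dec (q ≡ 1) → Colour
  internalColour s q (yes _) = suc (s + s) , 0
  internalColour s q (no _)  = s + s , q

  colour : Block → Colour
  colour (at∞ r)              = toℕ r + toℕ r , 1
  colour (at s q internal)    = internalColour (toℕ s) (toℕ q) (toℕ q ≟ⁿ 1)
  colour (at s q (cross σ δ)) = toℕ s + toℕ s + distance δ , toℕ q + bit σ

  cross-colour : ∀ s δ {t} → t ≡ₘ s + distance δ → s + s + distance δ ≡ₘ s + t
  cross-colour s δ {t} t≡s+d = begin
    s + s + distance δ      ≡⟨ +-assoc s s (distance δ) ⟩
    s + (s + distance δ)    ≈⟨ +-congˡₘ s t≡s+d ⟨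
    s + t                   ∎
    where open ≡ₘ-Reasoning

  step≢ₘ : ∀ s δ {t} → t ≡ₘ s + distance δ → ¬ t ≡ₘ s
  step≢ₘ s δ t≡s+d t≡s = shift≢ₘ s (0<distance δ) (distance<m δ) (≡ₘ-trans (≡ₘ-sym t≡s+d) t≡s)

  double≢cross : ∀ u s δ → u ≡ s ⊎ u ≡ₘ s + distance δ → ¬ u + u ≡ₘ s + s + distance δ
  double≢cross u s δ (inj₁ refl) 2u≡ = shift≢ₘ (s + s) (0<distance δ) (distance<m δ) (≡ₘ-sym 2u≡)
  double≢cross u s δ (inj₂ u≡s+d) 2u≡ = step≢ₘ s δ u≡s+d (+-cancelʳₘ u (begin
    u + u                   ≈⟨ 2u≡ ⟩
    s + s + distance δ      ≈⟨ cross-colour s δ u≡s+d ⟩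
    s + u                   ∎))
    where open ≡ₘ-Reasoning

  special≢cross : ∀ s s₂ δ → s ≡ₘ s₂ + distance δ → ¬ suc (s + s) ≡ₘ s₂ + s₂ + distance δ
  special≢cross s s₂ δ s≡s₂+d 2s+1≡ = shift≢ₘ s (s≤s z≤n) 1+d<m (begin
    s + suc (distance δ)    ≡⟨ +-suc s (distance δ) ⟩
    suc s + distance δ      ≈⟨ +-congʳₘ (distance δ) s+1≡s₂ ⟩
    s₂ + distance δ         ≈⟨ s≡s₂+d ⟨
    s                       ∎)
    where
    open ≡ₘ-Reasoning
    1+d<m : suc (distance δ) < m
    1+d<m = s≤s (≤-trans (s≤s (distance≤k δ)) (+-monoˡ-≤ k k≥1))
    s+1≡s₂ : suc s ≡ₘ s₂
    s+1≡s₂ = +-cancelʳₘ s (begin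
      suc (s + s)             ≈⟨ 2s+1≡ ⟩
      s₂ + s₂ + distance δ    ≈⟨ cross-colour s₂ δ s≡s₂+d ⟩
      s₂ + s                  ∎)

  centre≢cross-leaf : ∀ s₁ δ₁ s₂ δ₂ → s₁ ≡ₘ s₂ + distance δ₂ →
                      ¬ s₁ + s₁ + distance δ₁ ≡ₘ s₂ + s₂ + distance δ₂
  centre≢cross-leaf s₁ δ₁ s₂ δ₂ s₁≡s₂+d₂ colours = shift≢ₘ s₁ 0<d₁+d₂ d₁+d₂<m (begin
    s₁ + (distance δ₁ + distance δ₂)   ≡⟨ +-assoc s₁ _ _ ⟨
    s₁ + distance δ₁ + distance δ₂     ≈⟨ +-congʳₘ (distance δ₂) s₁+d₁≡s₂ ⟩
    s₂ + distance δ₂                   ≈⟨ s₁≡s₂+d₂ ⟨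
    s₁                                 ∎)
    where
    open ≡ₘ-Reasoning
    0<d₁+d₂ : 0 < distance δ₁ + distance δ₂
    0<d₁+d₂ = ≤-trans (0<distance δ₁) (m≤m+n _ _)
    d₁+d₂<m : distance δ₁ + distance δ₂ < m
    d₁+d₂<m = s≤s (+-mono-≤ (distance≤k δ₁) (distance≤k δ₂))
    s₁+d₁≡s₂ : s₁ + distance δ₁ ≡ₘ s₂
    s₁+d₁≡s₂ = +-cancelˡₘ s₁ (begin
      s₁ + (s₁ + distance δ₁)          ≡⟨ +-assoc s₁ s₁ _ ⟨
      s₁ + s₁ + distance δ₁            ≈⟨ colours ⟩
      s₂ + s₂ + distance δ₂            ≈⟨ cross-colour s₂ δ₂ s₁≡s₂+d₂ ⟩
      s₂ + s₁                          ≡⟨ +-comm s₂ s₁ ⟩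
      s₁ + s₂                          ∎)

  common-leaf⇒same-group : ∀ s₁ δ₁ s₂ δ₂ {t} → t ≡ₘ s₁ + distance δ₁ → t ≡ₘ s₂ + distance δ₂ →
                           s₁ + s₁ + distance δ₁ ≡ₘ s₂ + s₂ + distance δ₂ → s₁ ≡ₘ s₂
  common-leaf⇒same-group s₁ δ₁ s₂ δ₂ {t} t≡s₁+d₁ t≡s₂+d₂ colours = +-cancelʳₘ t (begin
    s₁ + t                   ≈⟨ cross-colour s₁ δ₁ t≡s₁+d₁ ⟨
    s₁ + s₁ + distance δ₁    ≈⟨ colours ⟩
    s₂ + s₂ + distance δ₂    ≈⟨ cross-colour s₂ δ₂ t≡s₂+d₂ ⟩
    s₂ + t                   ∎)
    where open ≡ₘ-Reasoning

  1<e : 1 < e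
  1<e = ≤-trans (s≤s (s≤s z≤n)) e≥3

  InGroup : Fin m → Point → Set
  InGroup u ∞           = ⊤
  InGroup u ⟨ t , _ ⟩   = u ≡ t

  incident-at∞ : ∀ r {y} → Incident (at∞ r) y → InGroup r y
  incident-at∞ r {∞}          _                = tt
  incident-at∞ r {⟨ t , q′ ⟩} (inj₂ (r≡t , _)) = r≡t

  incident-internal : ∀ s q {y} → Incident (at s q internal) y → InGroup s y
  incident-internal s q {∞}          _                = tt
  incident-internal s q {⟨ t , q′ ⟩} (inj₁ refl)      = refl
  incident-internal s q {⟨ t , q′ ⟩} (inj₂ (s≡t , _)) = s≡t

  incident-special : ∀ s q {y} → toℕ q ≡ 1 → Incident (at s q internal) y →
                     ∃ λ q′ → y ≡ ⟨ s , q′ ⟩ × 0 < toℕ q′ × toℕ q′ ≤ suc e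
  incident-special s q {∞} q≡1 (inj₂ e≤q) = ⊥-elim (<⇒≱ 1<e (subst (e ≤_) q≡1 e≤q))
  incident-special s q {⟨ t , q′ ⟩} q≡1 (inj₁ refl) =
    q , refl , subst (0 <_) (sym q≡1) (s≤s z≤n) , subst (_≤ suc e) (sym q≡1) (s≤s z≤n)
  incident-special s q {⟨ t , q′ ⟩} q≡1 (inj₂ (refl , inj₁ (q<q′ , q′≤q+e))) =
    q′ , refl , ≤-trans (s≤s z≤n) q<q′ , subst (λ x → toℕ q′ ≤ x + e) q≡1 q′≤q+e
  incident-special s q {⟨ t , q′ ⟩} q≡1 (inj₂ (refl , inj₂ q′+e<q)) =
    ⊥-elim (<⇒≱ (subst (toℕ q′ + e <_) q≡1 q′+e<q) (≤-trans (<⇒≤ 1<e) (m≤n+m e (toℕ q′))))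

  cross-incident-group : ∀ s q σ δ {y} → Incident (at s q (cross σ δ)) y →
                         ∃₂ λ t q′ → y ≡ ⟨ t , q′ ⟩ × (s ≡ t ⊎ Step s δ t)
  cross-incident-group s q σ δ {⟨ t , q′ ⟩} (inj₁ refl)     = t , q′ , refl , inj₁ refl
  cross-incident-group s q σ δ {⟨ t , q′ ⟩} (inj₂ (step , _)) = t , q′ , refl , inj₂ step

  grouped≢cross : ∀ u s q σ δ {y} → InGroup u y → Incident (at s q (cross σ δ)) y →
                  ¬ toℕ u + toℕ u ≡ₘ toℕ s + toℕ s + distance δ
  grouped≢cross u s q σ δ u∋y y∈cross with cross-incident-group s q σ δ y∈cross
  ... | t , q′ , refl , inj₁ refl = double≢cross (toℕ u) (toℕ s) δ (inj₁ (cong toℕ u∋y))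
  ... | t , q′ , refl , inj₂ step = double≢cross (toℕ u) (toℕ s) δ (inj₂ (subst (λ v → toℕ v ≡ₘ _) (sym u∋y) step))

  Proper : Block → Block → Set
  Proper b b′ = ∀ y → SameColour (colour b) (colour b′) → Incident b y → Incident b′ y → b ≡ b′

  proper-sym : ∀ {b b′} → Proper b b′ → Proper b′ b
  proper-sym proper y (same₁ , same₂) y∈b′ y∈b = sym (proper y (≡ₘ-sym same₁ , ≡ᵣ-sym same₂) y∈b y∈b′)

  1<e+e : 1 < e + e
  1<e+e = ≤-trans 1<e (m≤m+n e e)

  group-determined : ∀ {s s′ : Fin m} → toℕ s + toℕ s ≡ₘ toℕ s′ + toℕ s′ → s ≡ s′
  group-determined {s} {s′} 2s≡2s′ = toℕ-injective (≡ₘ⇒≡ (toℕ<n s) (toℕ<n s′) (double-cancelₘ k 2s≡2s′))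

  1<m : 1 < m
  1<m = s≤s (≤-trans k≥1 (m≤m+n k k))

  proper-∞-∞ : ∀ r r′ → Proper (at∞ r) (at∞ r′)
  proper-∞-∞ r r′ y (same , _) _ _ = cong at∞ (group-determined same)

  proper-∞-internal : ∀ r s q → Proper (at∞ r) (at s q internal)
  proper-∞-internal r s q y same _ _ = ⊥-elim (second (toℕ q ≟ⁿ 1) (proj₂ same))
    where
    second : (d : Dec (toℕ q ≡ 1)) → ¬ 1 ≡ᵣ proj₂ (internalColour (toℕ s) (toℕ q) d)
    second (yes _)  1≡0 = ≢ᵣ0 (s≤s z≤n) 1<e+e 1≡0
    second (no q≢1) 1≡q = q≢1 (sym (≡ᵣ⇒≡ 1<e+e (toℕ<n q) 1≡q))

  proper-∞-cross : ∀ r s q σ δ → Proper (at∞ r) (at s q (cross σ δ))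
  proper-∞-cross r s q σ δ y (same , _) y∈∞ y∈cross =
    ⊥-elim (grouped≢cross r s q σ δ (incident-at∞ r y∈∞) y∈cross same)

  proper-internal-internal : ∀ s q s′ q′ → Proper (at s q internal) (at s′ q′ internal)
  proper-internal-internal s q s′ q′ y = cases (toℕ q ≟ⁿ 1) (toℕ q′ ≟ⁿ 1)
    where
    cases : (d : Dec (toℕ q ≡ 1)) (d′ : Dec (toℕ q′ ≡ 1)) →
            SameColour (internalColour (toℕ s) (toℕ q) d) (internalColour (toℕ s′) (toℕ q′) d′) →
            Incident (at s q internal) y → Incident (at s′ q′ internal) y → at s q internal ≡ at s′ q′ internal
    cases (no _) (no _) (same₁ , same₂) _ _ =
      cong₂ (λ s q → at s q internal) (group-determined same₁) (toℕ-injective (≡ᵣ⇒≡ (toℕ<n q) (toℕ<n q′) same₂))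
    cases (yes q≡1) (yes q′≡1) (same₁ , _) _ _ =
      cong₂ (λ s q → at s q internal) (group-determined (+-cancelˡₘ 1 same₁)) (toℕ-injective (trans q≡1 (sym q′≡1)))
    cases (no _) (yes q′≡1) (same₁ , _) y∈b y∈b′ with incident-special s′ q′ q′≡1 y∈b′
    ... | _ , refl , _ with refl ← incident-internal s q y∈b = ⊥-elim (shift≢ₘ (toℕ s + toℕ s) (s≤s z≤n) 1<m
                                                                   (≡ₘ-trans (≡⇒≡ₘ (+-comm _ 1)) (≡ₘ-sym same₁)))
    cases (yes q≡1) (no _) (same₁ , _) y∈b y∈b′ with incident-special s q q≡1 y∈b
    ... | _ , refl , _ with refl ← incident-internal s′ q′ y∈b′ = ⊥-elim (shift≢ₘ (toℕ s + toℕ s) (s≤s z≤n) 1<m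
                                                                     (≡ₘ-trans (≡⇒≡ₘ (+-comm _ 1)) same₁))

  bit≤1 : ∀ σ → bit σ ≤ 1
  bit≤1 low  = z≤n
  bit≤1 high = s≤s z≤n

  bit-injective : ∀ {σ σ′} → bit σ ≡ bit σ′ → σ ≡ σ′
  bit-injective {low}  {low}  _ = refl
  bit-injective {high} {high} _ = refl

  proper-internal-cross : ∀ s q s₂ q₂ σ δ → Proper (at s q internal) (at s₂ q₂ (cross σ δ))
  proper-internal-cross s q s₂ q₂ σ δ y = cases (toℕ q ≟ⁿ 1)
    where
    cases : (d : Dec (toℕ q ≡ 1)) →
            SameColour (internalColour (toℕ s) (toℕ q) d) (toℕ s₂ + toℕ s₂ + distance δ , toℕ q₂ + bit σ) →
            Incident (at s q internal) y → Incident (at s₂ q₂ (cross σ δ)) y → at s q internal ≡ at s₂ q₂ (cross σ δ)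
    cases (no _) (same₁ , _) y∈b y∈cross =
      ⊥-elim (grouped≢cross s s₂ q₂ σ δ (incident-internal s q y∈b) y∈cross same₁)
    cases (yes q≡1) (same₁ , same₂) y∈b y∈cross with incident-special s q q≡1 y∈b
    ... | q′ , refl , 0<q′ , q′≤1+e with y∈cross
    ...   | inj₁ refl       = ⊥-elim (≢ᵣ0 (≤-trans 0<q′ (m≤m+n _ _)) q′+b<e+e (≡ᵣ-sym same₂))
      where
      q′+b<e+e : toℕ q′ + bit σ < e + e
      q′+b<e+e = ≤-<-trans (+-mono-≤ q′≤1+e (bit≤1 σ)) (subst (_< e + e) (+-suc e 1) (+-monoʳ-< e e≥3))
    ...   | inj₂ (step , _) = ⊥-elim (special≢cross (toℕ s) (toℕ s₂) δ step same₁)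

  proper-cross-cross : ∀ s q σ δ s′ q′ σ′ δ′ → Proper (at s q (cross σ δ)) (at s′ q′ (cross σ′ δ′))
  proper-cross-cross s q σ δ s′ q′ σ′ δ′ ⟨ t , q″ ⟩ (same₁ , same₂) (inj₁ refl) (inj₁ refl) =
    cong₂ (λ σ δ → at s q (cross σ δ))
          (bit-injective (≡ᵣ⇒≡ (≤-<-trans (bit≤1 σ) 1<e+e) (≤-<-trans (bit≤1 σ′) 1<e+e) (+-cancelˡᵣ (toℕ q) same₂)))
          (distance-injective (≡ₘ⇒≡ (distance<m δ) (distance<m δ′) (+-cancelˡₘ (toℕ s + toℕ s) same₁)))
  proper-cross-cross s q σ δ s′ q′ σ′ δ′ ⟨ t , q″ ⟩ (same₁ , _) (inj₁ refl) (inj₂ (step′ , _)) =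
    ⊥-elim (centre≢cross-leaf (toℕ s) δ (toℕ s′) δ′ step′ same₁)
  proper-cross-cross s q σ δ s′ q′ σ′ δ′ ⟨ t , q″ ⟩ (same₁ , _) (inj₂ (step , _)) (inj₁ refl) =
    ⊥-elim (centre≢cross-leaf (toℕ s′) δ′ (toℕ s) δ step (≡ₘ-sym same₁))
  proper-cross-cross s q σ δ s′ q′ σ′ δ′ ⟨ t , q″ ⟩ (same₁ , same₂) (inj₂ (step , side)) (inj₂ (step′ , side′))
    with refl ← toℕ-injective (≡ₘ⇒≡ (toℕ<n s) (toℕ<n s′)
                                    (common-leaf⇒same-group (toℕ s) δ (toℕ s′) δ′ step step′ same₁))
    with refl ← step-injective δ δ′ step step′
    with refl ← onSide-unique side side′
    = cong (λ q → at s q (cross σ δ)) (toℕ-injective (≡ᵣ⇒≡ (toℕ<n q) (toℕ<n q′) (+-cancelʳᵣ (bit σ) same₂)))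

  proper : ∀ b b′ → Proper b b′
  proper (at∞ r)              (at∞ r′)                 = proper-∞-∞ r r′
  proper (at∞ r)              (at s q internal)        = proper-∞-internal r s q
  proper (at∞ r)              (at s q (cross σ δ))     = proper-∞-cross r s q σ δ
  proper (at s q internal)    (at∞ r)                  = proper-sym (proper-∞-internal r s q)
  proper (at s q internal)    (at s′ q′ internal)      = proper-internal-internal s q s′ q′
  proper (at s q internal)    (at s′ q′ (cross σ δ))   = proper-internal-cross s q s′ q′ σ δ
  proper (at s q (cross σ δ)) (at∞ r)                  = proper-sym (proper-∞-cross r s q σ δ)
  proper (at s q (cross σ δ)) (at s′ q′ internal)      = proper-sym (proper-internal-cross s′ q′ s q σ δ)
  proper (at s q (cross σ δ)) (at s′ q′ (cross σ′ δ′)) = proper-cross-cross s q σ δ s′ q′ σ′ δ′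

  centreOf-toBlock : ∀ x r → centreOf (toBlock x r) ≡ x
  centreOf-toBlock ∞         r = refl
  centreOf-toBlock ⟨ s , q ⟩ r = refl

  colourAt : Fin n → Fin m → Colour
  colourAt c r = colour (toBlock (decode c) r)

  colourIndex : Fin n → Fin m → Fin (m * (e + e))
  colourIndex c r = combine (proj₁ (colourAt c r) mod m) (proj₂ (colourAt c r) mod (e + e))

  toℕ-mod : ∀ a d .{{_ : NonZero d}} → toℕ (a mod d) ≡ a % d
  toℕ-mod a d = toℕ-fromℕ< (m%n<n a d)

  sameColour : ∀ c r c′ r′ → colourIndex c r ≡ colourIndex c′ r′ → SameColour (colourAt c r) (colourAt c′ r′)
  sameColour c r c′ r′ eq =
      residue-≡  (trans (sym (toℕ-mod a m)) (trans (cong toℕ eq₁) (toℕ-mod a′ m)))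
    , residue-≡ᵣ (trans (sym (toℕ-mod b (e + e))) (trans (cong toℕ eq₂) (toℕ-mod b′ (e + e))))
    where
    a = proj₁ (colourAt c r)
    b = proj₂ (colourAt c r)
    a′ = proj₁ (colourAt c′ r′)
    b′ = proj₂ (colourAt c′ r′)
    eq₁ = proj₁ (combine-injective (a mod m) (b mod (e + e)) (a′ mod m) (b′ mod (e + e)) eq)
    eq₂ = proj₂ (combine-injective (a mod m) (b mod (e + e)) (a′ mod m) (b′ mod (e + e)) eq)

  open FromLeafRelation (λ c r v → Leaf (decode c) r (decode v)) (λ c r v → leaf? (decode c) r (decode v))
    (λ c r → count-leaf (decode c) r) (λ c r → leaf-irrefl (decode c) r)
    (λ u v u≢v → leaf-total (decode u) (decode v) (u≢v ∘ decode-injective))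
    (λ u r r′ v → leaf-unique (decode u) r r′ (decode v)) (λ u r v r′ → leaf-asym (decode u) r (decode v) r′)

  colourable : Σ (StarSystem n e) λ S → BlockColourable S (n ∸ 1)
  colourable = starSystem , blockColourable (m * (e + e)) colourIndex proper-colouring
    where
    incident : ∀ {c r v} → InStar c r v → Incident (toBlock (decode c) r) (decode v)
    incident {c} {r} (inj₁ c≡v) = inj₁ (trans (centreOf-toBlock (decode c) r) (cong decode c≡v))
    incident         (inj₂ leaf) = inj₂ leaf
    proper-colouring : ∀ c r c′ r′ v → colourIndex c r ≡ colourIndex c′ r′ →
                       InStar c r v → InStar c′ r′ v → c ≡ c′ × r ≡ r′
    proper-colouring c r c′ r′ v same v∈ v∈′
      with x≡x′ , r≡r′ ← toBlock-injective (decode c) r (decode c′) r′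
             (proper (toBlock (decode c) r) (toBlock (decode c′) r′) (decode v)
                     (sameColour c r c′ r′ same) (incident v∈) (incident v∈′))
      = decode-injective x≡x′ , r≡r′

open import Defs
open import Data.Nat using (_<_; _*_; _+_; _∸_; suc; z≤n; s≤s)
open import Data.Nat.Properties
open import Data.Nat.Divisibility using (divides)
open import Data.Nat.Tactic.RingSolver using (solve-∀)
open import Data.Integer using (+_; _-_)
open import Data.Integer.Divisibility using (_∣_)
import Data.Integer as ℤ
import Data.Integer.Properties as ℤ
open import Data.Product using (Σ; ∃; _×_; _,_)
open import Relation.Binary.PropositionalEquality
open StarSystems using (blockChromatic-order)

order≡1+m*2e : ∀ e n → 2 * e + 1 < n → + (4 * e) ∣ + n - + (2 * e + 1) →
         ∃ λ k → 1 ≤ k × n ≡ suc (suc (k + k) * (e + e))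
order≡1+m*2e e n x<n (divides q ∣n-x∣≡q*4e) = q , 1≤q , n≡
  where
  n∸x≡q*4e : n ∸ (2 * e + 1) ≡ q * (4 * e)
  n∸x≡q*4e = begin
    n ∸ (2 * e + 1)                  ≡⟨ ℤ.∣⊖∣-≤ (<⇒≤ x<n) ⟨
    ℤ.∣ (2 * e + 1) ℤ.⊖ n ∣          ≡⟨ ℤ.∣m⊖n∣≡∣n⊖m∣ n (2 * e + 1) ⟨
    ℤ.∣ n ℤ.⊖ (2 * e + 1) ∣          ≡⟨ cong ℤ.∣_∣ (ℤ.m-n≡m⊖n n (2 * e + 1)) ⟨
    ℤ.∣ + n - + (2 * e + 1) ∣        ≡⟨ ∣n-x∣≡q*4e ⟩
    q * (4 * e)                      ∎
    where open ≡-Reasoning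
  1≤q : 1 ≤ q
  1≤q = n≢0⇒n>0 λ q≡0 → <⇒≱ x<n (m∸n≡0⇒m≤n (trans n∸x≡q*4e (cong (_* (4 * e)) q≡0)))
  n≡ : n ≡ suc (suc (q + q) * (e + e))
  n≡ = begin
    n                                ≡⟨ m+[n∸m]≡n (<⇒≤ x<n) ⟨
    2 * e + 1 + (n ∸ (2 * e + 1))    ≡⟨ cong (_+_ (2 * e + 1)) n∸x≡q*4e ⟩
    2 * e + 1 + q * (4 * e)          ≡⟨ lemma e q ⟩
    suc (suc (q + q) * (e + e))      ∎
    where
    open ≡-Reasoning
    lemma : ∀ e q → 2 * e + 1 + q * (4 * e) ≡ suc (suc (q + q) * (e + e))
    lemma = solve-∀

theorem3p4 : (e n : ℕ) → 3 ≤ e → 1 ≤ n →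
    (+ (4 * e)) ∣ (+ n - + (2 * e + 1)) →
    ((2 * e + 1 < n → Σ (StarSystem n e) λ S → BlockColourable S (n ∸ 1)) ×
     (n ≡ 2 * e + 1 → (S : StarSystem n e) → BlockChromatic S n))
-- The hypothesis 1 ≤ n follows from either premise.
theorem3p4 e n e≥3 _ 4e∣n-x = colourable , chromatic
  where
  colourable : 2 * e + 1 < n → Σ (StarSystem n e) λ S → BlockColourable S (n ∸ 1)
  colourable x<n with k , k≥1 , n≡ ← order≡1+m*2e e n x<n 4e∣n-x
    = subst (λ N → Σ (StarSystem N e) λ S → BlockColourable S (N ∸ 1)) (sym n≡)
            (Construction.colourable e k e≥3 k≥1)
  chromatic : n ≡ 2 * e + 1 → (S : StarSystem n e) → BlockChromatic S n
  chromatic n≡x = subst (λ N → (S : StarSystem N e) → BlockChromatic S N)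
                        (sym (trans n≡x (twice+1 e)))
                        (blockChromatic-order (≤-trans (s≤s z≤n) e≥3))
    where
    twice+1 : ∀ e → 2 * e + 1 ≡ suc (e + e)
    twice+1 = solve-∀
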